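{- Let $G$ and $\mathcal{T}_G$, $\mathcal{J}$ be as in the context. For every $\iota=i_1\dots i_k\in\mathcal{J}$ and every $n\in\mathbb{N}$: $\mathcal{T}_G\models A\sqsubseteq\bigcirc^nC_\iota$ if and only if there exist $n_1,\dots,n_k\in\mathbb{N}$ with $n=n_1+\dots+n_k$ such that $\mathcal{T}_G\models A\sqsubseteq\bigcirc^{n_j}B_{i_j}$ for all $1\le j\le k$.
   Context: TBoxes: finite sets of concept inclusions $A\sqsubseteq\bigcirc^nB$, $A\sqcap A'\sqsubseteq B$, $\exists r.A\sqsubseteq B$, $A\sqsubseteq\exists r.B$ with temporal semantics: an interpretation is a family $(\mathcal{I}_i)_{i\in\mathbb{Z}}$ of classical DL interpretations over a common domain, rigid role names interpreted identically at all $i$; $(\bigcirc^nA)^{i}=A^{i+n}$, $\sqcap$ is intersection, $(\exists r.A)^i=\{d\mid\exists e\in A^i,(d,e)\in r^i\}$; $C\sqsubseteq D$ holds if $C^i\subseteq D^i$ for all $i$; $\models$ is entailment over all models. Let $G=(N,\{c\},R)$ be a unary conjunctive grammar (semantics: $L_G(X)$ is the set of words $w$ with $X(w)$ derivable from the axiom $c(c)$ where each rule $\mathcal{N}\to\alpha_1\&\dots\&\alpha_n$ allows to infer $\mathcal{N}(w)$ from $X^i_j(u^i_j)$ whenever $\alpha_i=X^i_1\cdots X^i_{k_i}$ and $u^i_1\cdots u^i_{k_i}=w$ for every $i$) with $N=\{\mathcal{B}_1,\dots,\mathcal{B}_m\}$ and all rules of the forms $\mathcal{B}_i\to\varepsilon$,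 $\mathcal{B}_i\to c^n$ ($n>0$), $\mathcal{B}_i\to\alpha_1$, $\mathcal{B}_i\to\alpha_1\&\alpha_2$ with $\alpha_1,\alpha_2$ nonempty strings of nonterminals. For a string $\alpha=\mathcal{B}_{i_1}\cdots\mathcal{B}_{i_k}$ let $\iota(\alpha)=i_1\dots i_k$. Let $\mathcal{J}$ be the set of all nonempty suffixes $i_j\dots i_k$ ($1\le j\le k$) of sequences $\iota(\alpha)$ for strings $\alpha$ occurring in rules of $G$. Use concept names $A,B_1,\dots,B_m$, $C_\iota$ for $\iota\in\mathcal{J}$, and rigid role names $r_\iota$ for $\iota\in\mathcal{J}$ of length at least 2. For $\iota\in\mathcal{J}$, $i\iota$ denotes the sequence with $i$ prepended. $\mathcal{T}_G$ consists exactly of: $A\sqsubseteq B_i$ for each rule $\mathcal{B}_i\to\varepsilon$; $A\sqsubseteq\bigcirc^nB_i$ for each rule $\mathcal{B}_i\to c^n$; $C_{\iota(\alpha_1)}\sqsubseteq B_i$ for each rule $\mathcal{B}_i\to\alpha_1$; $C_{\iota(\alpha_1)}\sqcap C_{\iota(\alpha_2)}\sqsubseteq B_i$ for each rule $\mathcal{B}_i\to\alpha_1\&\alpha_2$; $B_i\sqsubseteq\exists r_{i\iota}.A$ for each $i\iota\in\mathcal{J}$ with $\iota$ nonempty; $\exists r_{i\iota}.C_\iota\sqsubseteq C_{i\iota}$ for all $\iota,i\iota\in\mathcal{J}$; $B_i\sqsubseteq C_i$ for each $i$ such that the one-element sequence $i$ is in $\mathcal{J}$. -}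

module Defs where

open import Data.Nat using (ℕ; _<_)
open import Data.Integer using (ℤ; +_) renaming (_+_ to _+ℤ_)
open import Data.Fin using (Fin)
open import Data.List using (List; []; _∷_; _++_)
open import Data.List.NonEmpty using (List⁺; toList)
open import Data.List.Membership.Propositional using (_∈_)
open import Data.Product using (Σ; _×_; ∃)
open import Relation.Binary.PropositionalEquality using (_≡_; _≢_)

-- Unary conjunctive grammars in the restricted normal form.
-- Nonterminals B₁..Bₘ are represented by Fin m; the single terminal c
-- and the axiom c(c) are implicit.

data Rule (m : ℕ) : Set where
  ε-rule   : Fin m → Rule m
  c-rule   : Fin m → (n : ℕ) → 0 < n → Rule m
  one-rule : Fin m → List⁺ (Fin m) → Rule m
  and-rule : Fin m → List⁺ (Fin m) → List⁺ (Fin m) → Rule m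

Grammar : ℕ → Set
Grammar m = List (Rule m)

strings : ∀ {m} → Rule m → List (List (Fin m))
strings (ε-rule _)        = []
strings (c-rule _ _ _)    = []
strings (one-rule _ α)    = toList α ∷ []
strings (and-rule _ α β)  = toList α ∷ toList β ∷ []

InJ : ∀ {m} → Grammar m → List (Fin m) → Set
InJ {m} G ι =
  (ι ≢ []) ×
  Σ (Rule m) λ ρ → (ρ ∈ G) ×
  Σ (List (Fin m)) λ α → (α ∈ strings ρ) ×
  Σ (List (Fin m)) λ β → β ++ ι ≡ α

data CName (m : ℕ) : Set where
  A : CName m
  B : Fin m → CName m
  C : List (Fin m) → CName m

RName : ℕ → Set
RName m = List (Fin m)

data CI (m : ℕ) : Set where
  _⊑○^_∙_ : CName m → ℕ → CName m → CI m
  _⊓_⊑_   : CName m → CName m → CName m → CI m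
  ∃_∙_⊑_  : RName m → CName m → CName m → CI m
  _⊑∃_∙_  : CName m → RName m → CName m → CI m

-- Temporal interpretations: a family (𝓘ᵢ)_{i∈ℤ} over a common domain;
-- all role names used are rigid, so they are interpreted time-independently.

record Interp (m : ℕ) : Set₁ where
  field
    Δ    : Set
    conc : CName m → ℤ → Δ → Set
    role : RName m → Δ → Δ → Set

open Interp public

_⊨ᶜⁱ_ : ∀ {m} → Interp m → CI m → Set
I ⊨ᶜⁱ (X ⊑○^ n ∙ Y) = ∀ i d → conc I X i d → conc I Y (i +ℤ + n) d
I ⊨ᶜⁱ (X ⊓ X' ⊑ Y)  = ∀ i d → conc I X i d → conc I X' i d → conc I Y i d
I ⊨ᶜⁱ (∃ r ∙ X ⊑ Y) = ∀ i d e → role I r d e → conc I X i e → conc I Y i d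
I ⊨ᶜⁱ (X ⊑∃ r ∙ Y)  = ∀ i d → conc I X i d → Σ (Δ I) λ e → role I r d e × conc I Y i e

data 𝒯 {m : ℕ} (G : Grammar m) : CI m → Set where
  ax-ε   : ∀ {i} → ε-rule i ∈ G → 𝒯 G (A ⊑○^ 0 ∙ B i)
  ax-c   : ∀ {i n} {p : 0 < n} → c-rule i n p ∈ G → 𝒯 G (A ⊑○^ n ∙ B i)
  ax-one : ∀ {i α} → one-rule i α ∈ G → 𝒯 G (C (toList α) ⊑○^ 0 ∙ B i)
  ax-and : ∀ {i α β} → and-rule i α β ∈ G →
           𝒯 G (C (toList α) ⊓ C (toList β) ⊑ B i)
  ax-∃R  : ∀ {i ι} → ι ≢ [] → InJ G (i ∷ ι) → 𝒯 G (B i ⊑∃ (i ∷ ι) ∙ A)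
  ax-∃L  : ∀ {i ι} → InJ G ι → InJ G (i ∷ ι) → 𝒯 G (∃ (i ∷ ι) ∙ C ι ⊑ C (i ∷ ι))
  ax-BC  : ∀ {i} → InJ G (i ∷ []) → 𝒯 G (B i ⊑○^ 0 ∙ C (i ∷ []))

Model : ∀ {m} → Grammar m → Interp m → Set
Model G I = ∀ ax → 𝒯 G ax → I ⊨ᶜⁱ ax

_⊨_ : ∀ {m} → Grammar m → CI m → Set₁
G ⊨ ax = ∀ (I : Interp _) → Model G I → I ⊨ᶜⁱ ax

-- Soundness: if A ⊑ ○^{nⱼ} B_{iⱼ} for ι = i₁…iₖ, then from A at time t the axioms
-- B_{i₁} ⊑ ∃r_ι.A and ∃r_ι.C_{i₂…iₖ} ⊑ C_ι walk along ι, each step spawning a fresh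
-- A-element at the time the previous block ends, so C_ι holds at t + n₁ + … + nₖ.
-- Completeness: read the grammar as an inductive derivation relation and build the
-- canonical model on ℤ, where s ∈ Xᵗ iff c^{t−s} is derivable from X (from C_ι
-- meaning: a concatenation of words derivable from the B_{iⱼ}). It is a model of 𝒯_G in
-- which s ∈ Aˢ, so an entailment A ⊑ ○ⁿ C_ι splits n into derivable blocks, and
-- derivable blocks are entailed by soundness.
module Submission where

open import Defs
open import Data.Nat using (ℕ)
open import Data.Fin using (Fin)
open import Data.List using (List)
open import Data.Nat.ListAction using (sum)
open import Data.List.Relation.Binary.Pointwise using (Pointwise)
open import Data.Product using (Σ; _×_)
open import Function.Bundles using (_⇔_)
open import Relation.Binary.PropositionalEquality using (_≡_)

open import Data.Nat using (_<_) renaming (_+_ to _+ℕ_)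
open import Data.Integer using (ℤ; +_) renaming (_+_ to _+ℤ_)
import Data.Integer.Properties as ℤ
open import Algebra.Properties.AbelianGroup ℤ.+-0-abelianGroup using (∙-cancelˡ)
open import Data.List using ([]; _∷_; _++_)
open import Data.List.Properties using (++-assoc)
open import Data.List.NonEmpty using (List⁺; toList; _∷_)
open import Data.List.Relation.Unary.Any using (here; there)
open import Data.List.Membership.Propositional using (_∈_)
open import Data.List.Relation.Binary.Pointwise using ([]; _∷_)
import Data.List.Relation.Binary.Pointwise as Pointwise
open import Data.Product using (_,_; proj₁)
open import Data.Empty using (⊥; ⊥-elim)
open import Function.Bundles using (mk⇔)
open import Relation.Binary.PropositionalEquality
  using (_≢_; refl; sym; trans; cong; subst; module ≡-Reasoning)

+-+-assoc : ∀ (t : ℤ) m n → (t +ℤ + m) +ℤ + n ≡ t +ℤ + (m +ℕ n)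
+-+-assoc t m n = trans (ℤ.+-assoc t (+ m) (+ n)) (cong (t +ℤ_) (sym (ℤ.pos-+ m n)))

+-cancelˡ-pos : ∀ (s : ℤ) m n → s +ℤ + m ≡ s +ℤ + n → m ≡ n
+-cancelˡ-pos s m n eq = ℤ.+-injective (∙-cancelˡ s (+ m) (+ n) eq)

InJ-tail : ∀ {m} {G : Grammar m} {i ι} → InJ G (i ∷ ι) → ι ≢ [] → InJ G ι
InJ-tail {i = i} {ι} (_ , ρ , ρ∈G , α , α∈ρ , β , β++iι≡α) ι≢[] =
  ι≢[] , ρ , ρ∈G , α , α∈ρ , β ++ (i ∷ []) , trans (++-assoc β (i ∷ []) ι) β++iι≡α

InJ-string : ∀ {m} {G : Grammar m} {ρ} {α : List⁺ (Fin m)} →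
             ρ ∈ G → toList α ∈ strings ρ → InJ G (toList α)
InJ-string {α = _ ∷ _} ρ∈G α∈ρ = (λ ()) , _ , ρ∈G , _ , α∈ρ , [] , refl

module _ {m} {G : Grammar m} {I : Interp m} (model : Model G I) where

  Model-⊨-A⊑C : ∀ {ns ι} → InJ G ι →
                Pointwise (λ n i → I ⊨ᶜⁱ (A ⊑○^ n ∙ B i)) ns ι →
                I ⊨ᶜⁱ (A ⊑○^ sum ns ∙ C ι)
  Model-⊨-A⊑C ι∈J [] = ⊥-elim (proj₁ ι∈J refl)
  Model-⊨-A⊑C {n ∷ []} {i ∷ []} i∈J (A⊑B ∷ []) t d a =
    subst (λ u → conc I (C (i ∷ [])) u d) (+-+-assoc t n 0)
      (model _ (ax-BC i∈J) (t +ℤ + n) d (A⊑B t d a))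
  Model-⊨-A⊑C {n ∷ ns} {i ∷ k ∷ ι} iι∈J (A⊑B ∷ A⊑Bs) t d a
    with model _ (ax-∃R (λ ()) iι∈J) (t +ℤ + n) d (A⊑B t d a)
  ... | e , d-r-e , e∈A =
    subst (λ u → conc I (C (i ∷ k ∷ ι)) u d) (+-+-assoc t n (sum ns))
      (model _ (ax-∃L kι∈J iι∈J) ((t +ℤ + n) +ℤ + sum ns) d e d-r-e
        (Model-⊨-A⊑C kι∈J A⊑Bs (t +ℤ + n) e e∈A))
    where
    kι∈J : InJ G (k ∷ ι)
    kι∈J = InJ-tail iι∈J (λ ())

-- Derivable G n i says c^n ∈ L_G(𝓑ᵢ); Pointwise over ι(α) is concatenation.
data Derivable {m} (G : Grammar m) : ℕ → Fin m → Set where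
  by-ε   : ∀ {i} → ε-rule i ∈ G → Derivable G 0 i
  by-c   : ∀ {i n} {0<n : 0 < n} → c-rule i n 0<n ∈ G → Derivable G n i
  by-one : ∀ {i α ns} → one-rule i α ∈ G →
           Pointwise (Derivable G) ns (toList α) → Derivable G (sum ns) i
  by-and : ∀ {i α β ns ms} → and-rule i α β ∈ G →
           Pointwise (Derivable G) ns (toList α) →
           Pointwise (Derivable G) ms (toList β) →
           sum ns ≡ sum ms → Derivable G (sum ns) i

module _ {m} {G : Grammar m} {I : Interp m} (model : Model G I) where

  Model-⊨-Derivable : ∀ {n i} → Derivable G n i → I ⊨ᶜⁱ (A ⊑○^ n ∙ B i)
  Model-⊨-Derivables : ∀ {ns ι} → Pointwise (Derivable G) ns ι →
                       Pointwise (λ n i → I ⊨ᶜⁱ (A ⊑○^ n ∙ B i)) ns ι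

  Model-⊨-Derivable (by-ε ρ∈G) = model _ (ax-ε ρ∈G)
  Model-⊨-Derivable (by-c ρ∈G) = model _ (ax-c ρ∈G)
  Model-⊨-Derivable (by-one {ns = ns} ρ∈G ds) t d a =
    subst (λ u → conc I (B _) u d) (ℤ.+-identityʳ _)
      (model _ (ax-one ρ∈G) (t +ℤ + sum ns) d
        (Model-⊨-A⊑C model (InJ-string ρ∈G (here refl)) (Model-⊨-Derivables ds) t d a))
  Model-⊨-Derivable (by-and ρ∈G ds es ∑ds≡∑es) t d a =
    model _ (ax-and ρ∈G) _ d
      (Model-⊨-A⊑C model (InJ-string ρ∈G (here refl)) (Model-⊨-Derivables ds) t d a)
      (subst (λ n → conc I (C _) (t +ℤ + n) d) (sym ∑ds≡∑es)
        (Model-⊨-A⊑C model (InJ-string ρ∈G (there (here refl))) (Model-⊨-Derivables es) t d a))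

  Model-⊨-Derivables []       = []
  Model-⊨-Derivables (d ∷ ds) = Model-⊨-Derivable d ∷ Model-⊨-Derivables ds

-- The element s stands for the start of a word: X holds at s at time t iff c^{t−s}
-- is derivable from X, and r_{iι} links s to the end of a word derivable from 𝓑ᵢ.
canonical : ∀ {m} → Grammar m → Interp m
canonical {m} G = record { Δ = ℤ ; conc = holds ; role = link }
  where
  holds : CName m → ℤ → ℤ → Set
  holds A     t s = t ≡ s
  holds (B i) t s = Σ ℕ λ n → (t ≡ s +ℤ + n) × Derivable G n i
  holds (C ι) t s = Σ (List ℕ) λ ns → (t ≡ s +ℤ + sum ns) × Pointwise (Derivable G) ns ι
  link : RName m → ℤ → ℤ → Set
  link []      s s' = ⊥
  link (i ∷ _) s s' = Σ ℕ λ n → (s' ≡ s +ℤ + n) × Derivable G n i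

canonical-model : ∀ {m} (G : Grammar m) → Model G (canonical G)
canonical-model G _ (ax-ε ρ∈G) t s t≡s = 0 , cong (_+ℤ + 0) t≡s , by-ε ρ∈G
canonical-model G _ (ax-c {n = n} ρ∈G) t s t≡s = n , cong (_+ℤ + n) t≡s , by-c ρ∈G
canonical-model G _ (ax-one ρ∈G) t s (ns , t≡s+∑ns , ds) =
  sum ns , trans (ℤ.+-identityʳ t) t≡s+∑ns , by-one ρ∈G ds
canonical-model G _ (ax-and ρ∈G) t s (ns , t≡s+∑ns , ds) (ms , t≡s+∑ms , es) =
  sum ns , t≡s+∑ns ,
  by-and ρ∈G ds es (+-cancelˡ-pos s _ _ (trans (sym t≡s+∑ns) t≡s+∑ms))
canonical-model G _ (ax-∃R _ _) t s (n , t≡s+n , d) = t , (n , t≡s+n , d) , refl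
canonical-model G _ (ax-∃L _ _) t s s' (n , s'≡s+n , d) (ns , t≡s'+∑ns , ds) =
  n ∷ ns , t≡s+n+∑ns , d ∷ ds
  where
  open ≡-Reasoning
  t≡s+n+∑ns : t ≡ s +ℤ + (n +ℕ sum ns)
  t≡s+n+∑ns = begin
    t                       ≡⟨ t≡s'+∑ns ⟩
    s' +ℤ + sum ns          ≡⟨ cong (_+ℤ + sum ns) s'≡s+n ⟩
    (s +ℤ + n) +ℤ + sum ns  ≡⟨ +-+-assoc s n (sum ns) ⟩
    s +ℤ + (n +ℕ sum ns)    ∎
canonical-model G _ (ax-BC _) t s (n , t≡s+n , d) =
  n ∷ [] , trans (cong (_+ℤ + 0) t≡s+n) (+-+-assoc s n 0) , d ∷ []

⊨-A⊑C⇒Derivables : ∀ {m} {G : Grammar m} {ι n} → G ⊨ (A ⊑○^ n ∙ C ι) →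
                   Σ (List ℕ) λ ns → (sum ns ≡ n) × Pointwise (Derivable G) ns ι
⊨-A⊑C⇒Derivables {G = G} A⊑C
  with A⊑C (canonical G) (canonical-model G) (+ 0) (+ 0) refl
... | ns , n≡∑ns , ds = ns , sym (ℤ.+-injective n≡∑ns) , ds

lemma2 : ∀ {m} (G : Grammar m) (ι : List (Fin m)) → InJ G ι → (n : ℕ) →
         (G ⊨ (A ⊑○^ n ∙ C ι)) ⇔
         Σ (List ℕ) (λ ns → (sum ns ≡ n) ×
           Pointwise (λ nⱼ iⱼ → G ⊨ (A ⊑○^ nⱼ ∙ B iⱼ)) ns ι)
lemma2 G ι ι∈J n = mk⇔ decompose compose
  where
  Split : Set₁
  Split = Σ (List ℕ) λ ns → (sum ns ≡ n) ×
            Pointwise (λ nⱼ iⱼ → G ⊨ (A ⊑○^ nⱼ ∙ B iⱼ)) ns ι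

  decompose : G ⊨ (A ⊑○^ n ∙ C ι) → Split
  decompose A⊑C with ⊨-A⊑C⇒Derivables A⊑C
  ... | ns , ∑ns≡n , ds = ns , ∑ns≡n , Pointwise.map (λ d I model → Model-⊨-Derivable model d) ds

  compose : Split → G ⊨ (A ⊑○^ n ∙ C ι)
  compose (ns , ∑ns≡n , A⊑Bs) I model t d a =
    subst (λ k → conc I (C ι) (t +ℤ + k) d) ∑ns≡n
      (Model-⊨-A⊑C model ι∈J (Pointwise.map (λ A⊑B → A⊑B I model) A⊑Bs) t d a)
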